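{- Let $f(x)$ be a polynomial of degree $2$ with nonnegative integer coefficients. Then for every integer $m\ge 2$, $$\operatorname{lcm}(f(m-1),f(m))\ge \frac{(m(m-1))^2}{2m-1}.$$ -}

module Defs where

open import Data.Nat using (ℕ; _+_; _*_)

-- The degree-2 polynomial f(x) = a x^2 + b x + c with nonnegative integer
-- coefficients (a ≠ 0 is imposed in the statement), evaluated at x ∈ ℕ.
quad : ℕ → ℕ → ℕ → ℕ → ℕ
quad a b c x = a * (x * x) + b * x + c

-- Put m = n + 1, so that f(n + 1) − f(n) = a(2n + 1) + b =: Δ. Since
-- gcd(f(n), f(n + 1)) divides Δ, lcm(f(n), f(n + 1)) · Δ ≥ f(n) · f(n + 1).
-- Now f(n + 1) ≥ (n + 1)² because a ≥ 1, and f(n) · (2n + 1) ≥ n² · Δ because the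
-- difference b n² + b n + c (2n + 1) is nonnegative; multiplying and cancelling Δ
-- gives lcm · (2n + 1) ≥ (n (n + 1))².
module Submission where

open import Data.Nat using (ℕ; suc; _+_; _*_; _∸_; _≤_; _^_; NonZero)
open import Data.Nat.Properties
open import Data.Nat.Divisibility using (_∣_; ∣m+n∣m⇒∣n; ∣⇒≤)
open import Data.Nat.GCD using (gcd; gcd[m,n]∣m; gcd[m,n]∣n)
open import Data.Nat.LCM using (lcm; gcd*lcm)
open import Data.Nat.Tactic.RingSolver using (solve-∀)
open import Algebra.Properties.CommutativeSemigroup *-commutativeSemigroup using (xy∙z≈xz∙y)
open import Relation.Binary.PropositionalEquality
open import Defs

gcd[m,m+d]∣d : ∀ m d → gcd m (m + d) ∣ d
gcd[m,m+d]∣d m d = ∣m+n∣m⇒∣n (gcd[m,n]∣n m (m + d)) (gcd[m,n]∣m m (m + d))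

gcd≤d⇒m*n≤lcm*d : ∀ m n d → gcd m n ≤ d → m * n ≤ lcm m n * d
gcd≤d⇒m*n≤lcm*d m n d gcd≤d = begin
  m * n             ≡⟨ gcd*lcm m n ⟨
  gcd m n * lcm m n ≤⟨ *-monoˡ-≤ (lcm m n) gcd≤d ⟩
  d * lcm m n       ≡⟨ *-comm d (lcm m n) ⟩
  lcm m n * d       ∎
  where open ≤-Reasoning

Δquad : ℕ → ℕ → ℕ → ℕ
Δquad a b x = a * (1 + 2 * x) + b

quad-suc : ∀ a b c x → quad a b c (suc x) ≡ quad a b c x + Δquad a b x
quad-suc = polynomial-identity
  where
  polynomial-identity : ∀ a b c x → a * (suc x * suc x) + b * suc x + c
                                  ≡ a * (x * x) + b * x + c + (a * (1 + 2 * x) + b)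
  polynomial-identity = solve-∀

gcd[quad,quad-suc]∣Δquad : ∀ a b c x → gcd (quad a b c x) (quad a b c (suc x)) ∣ Δquad a b x
gcd[quad,quad-suc]∣Δquad a b c x =
  subst (λ y → gcd (quad a b c x) y ∣ Δquad a b x) (sym (quad-suc a b c x))
        (gcd[m,m+d]∣d (quad a b c x) (Δquad a b x))

x*x≤quad : ∀ a b c x .{{_ : NonZero a}} → x * x ≤ quad a b c x
x*x≤quad a b c x = begin
  x * x                     ≤⟨ m≤n*m (x * x) a ⟩
  a * (x * x)               ≤⟨ m≤m+n _ (b * x) ⟩
  a * (x * x) + b * x       ≤⟨ m≤m+n _ c ⟩
  a * (x * x) + b * x + c   ∎
  where open ≤-Reasoning

x*x*Δquad≤quad*[1+2x] : ∀ a b c x → x * x * Δquad a b x ≤ quad a b c x * (1 + 2 * x)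
x*x*Δquad≤quad*[1+2x] a b c x =
  subst (x * x * Δquad a b x ≤_) (sym (expand a b c x)) (m≤m+n _ _)
  where
  expand : ∀ a b c x → (a * (x * x) + b * x + c) * (1 + 2 * x)
                     ≡ x * x * (a * (1 + 2 * x) + b) + (b * x * x + b * x + c * (1 + 2 * x))
  expand = solve-∀

2*[1+n]∸1≡1+2*n : ∀ n → 2 * suc n ∸ 1 ≡ 1 + 2 * n
2*[1+n]∸1≡1+2*n n = cong (_∸ 1) (*-distribˡ-+ 2 1 n)

lemma3p2 : (a b c : ℕ) → 1 ≤ a → (m : ℕ) → 2 ≤ m →
           (m * (m ∸ 1)) ^ 2 ≤ lcm (quad a b c (m ∸ 1)) (quad a b c m) * (2 * m ∸ 1)
lemma3p2 a@(suc _) b c _ (suc n) _ rewrite 2*[1+n]∸1≡1+2*n n =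
  *-cancelʳ-≤ _ _ Δ (begin
    (suc n * n) ^ 2 * Δ                ≡⟨ square-split (suc n) n Δ ⟩
    n * n * Δ * (suc n * suc n)        ≤⟨ *-mono-≤ (x*x*Δquad≤quad*[1+2x] a b c n)
                                                    (x*x≤quad a b c (suc n)) ⟩
    f n * (1 + 2 * n) * f (suc n)      ≡⟨ xy∙z≈xz∙y (f n) _ _ ⟩
    f n * f (suc n) * (1 + 2 * n)      ≤⟨ *-monoˡ-≤ _ (gcd≤d⇒m*n≤lcm*d (f n) (f (suc n)) Δ gcd≤Δ) ⟩
    ℓ * Δ * (1 + 2 * n)                ≡⟨ xy∙z≈xz∙y ℓ Δ _ ⟩
    ℓ * (1 + 2 * n) * Δ                ∎)
  where
  open ≤-Reasoning
  f : ℕ → ℕ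
  f = quad a b c
  Δ ℓ : ℕ
  Δ = Δquad a b n
  ℓ = lcm (f n) (f (suc n))
  gcd≤Δ : gcd (f n) (f (suc n)) ≤ Δ
  gcd≤Δ = ∣⇒≤ (gcd[quad,quad-suc]∣Δquad a b c n)
  -- (m * n) ^ 2 written out as it unfolds, in a form the ring solver accepts
  square-split : ∀ m n d → m * n * (m * n * 1) * d ≡ n * n * d * (m * m)
  square-split = solve-∀
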